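{- Let $P$ be a poset and let $\overline{down(P)}$ be the closure of $down(P)=\{\downarrow x:x\in P\}$ in $\mathfrak P(P)$ with the product topology. Then $\emptyset\notin\overline{down(P)}$ if and only if $P=\uparrow X$ for some finite subset $X$ of $P$ (i.e. $P$ is a finitely generated final segment of itself).
   Context: $\downarrow x=\{y\in P:y\le x\}$; $\uparrow X=\{y\in P: x\le y\text{ for some }x\in X\}$. $\mathfrak P(P)$ is identified with $2^P$ with the product topology. -}

module Defs where

open import Level using (Level; _⊔_)
open import Data.Product using (Σ; ∃; ∃-syntax; _×_; _,_)
open import Data.List using (List)
open import Data.List.Relation.Unary.All using (All)
open import Data.List.Relation.Unary.Any using (Any)
open import Data.Empty.Polymorphic using (⊥)
open import Relation.Unary using (Pred)
open import Relation.Binary.Bundles using (Poset)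

module _ {c ℓ₁ ℓ₂ : Level} (P : Poset c ℓ₁ ℓ₂) where
  open Poset P

  ↓ : Carrier → Pred Carrier ℓ₂
  ↓ x y = y ≤ x

  ∅ : Pred Carrier ℓ₂
  ∅ _ = ⊥

  AgreeOn : List Carrier → Pred Carrier ℓ₂ → Pred Carrier ℓ₂ → Set (c ⊔ ℓ₂)
  AgreeOn F A B = All (λ y → (A y → B y) × (B y → A y)) F

  -- A lies in the closure of down(P) = { ↓x : x ∈ P } in the product topology
  -- on 2^P: every basic open neighbourhood of A (determined by a finite set F
  -- of coordinates) meets down(P).
  InClosureDown : Pred Carrier ℓ₂ → Set (c ⊔ ℓ₂)
  InClosureDown A = (F : List Carrier) → ∃[ x ] AgreeOn F A (↓ x)

  ↑ : List Carrier → Pred Carrier (c ⊔ ℓ₂)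
  ↑ X y = Any (λ x → x ≤ y) X

  FinitelyGeneratedFinalSegment : Set (c ⊔ ℓ₂)
  FinitelyGeneratedFinalSegment = ∃[ X ] ((p : Carrier) → ↑ X p)

{-# OPTIONS --safe #-}
module Submission where

open import Defs
open import Level using (Level; _⊔_)
open import Relation.Nullary using (¬_)
open import Relation.Nullary.Negation using (¬∃⟶∀¬; ∀⟶¬∃¬)
open import Relation.Binary.Bundles using (Poset)
open import Function.Base using (_∘_)
open import Function.Bundles using (_⇔_; mk⇔; Equivalence)
open import Function.Construct.Composition using (_⇔-∘_)
open import Function.Related.TypeIsomorphisms using (¬-cong-⇔)
open import Axiom.ExcludedMiddle using (ExcludedMiddle)
open import Axiom.DoubleNegationElimination using (DoubleNegationElimination; em⇒dne)
open import Data.Product using (∃-syntax; _×_; _,_; map₂)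
open import Data.List using (List)
import Data.List.Relation.Unary.All as All
open import Data.List.Relation.Unary.All.Properties using (¬Any⇒All¬; All¬⇒¬Any)
open import Data.Empty using (⊥-elim)
import Data.Empty.Polymorphic as Polymorphic

-- A basic neighbourhood of ∅ fixes finitely many coordinates F to be absent,
-- and ↓ x meets it exactly when x lies outside ↑ F. So ∅ is in the closure of
-- down(P) iff no finite F generates P, and the theorem is the classical
-- negation of that.

-- Q is valued in the join of all levels so that one instance of double
-- negation elimination covers every type eliminated below.
¬∀∃¬⇔∃∀ : {a b q : Level} {A : Set a} {B : Set b} {Q : A → B → Set (a ⊔ b ⊔ q)} →
  DoubleNegationElimination (a ⊔ b ⊔ q) →
  (¬ (∀ F → ∃[ x ] ¬ Q F x)) ⇔ (∃[ F ] ∀ x → Q F x)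
¬∀∃¬⇔∃∀ {Q = Q} dne = mk⇔ ¬∀∃¬⇒∃∀ λ { (F , ∀Q) ∀∃¬ → ∀⟶¬∃¬ ∀Q (∀∃¬ F) }
  where
  ¬∀∃¬⇒∃∀ : ¬ (∀ F → ∃[ x ] ¬ Q F x) → ∃[ F ] ∀ x → Q F x
  ¬∀∃¬⇒∃∀ ¬∀∃¬ = dne λ ¬∃∀ → ¬∀∃¬ λ F → dne λ ¬∃¬ →
    ¬∃∀ (F , λ x → dne (¬∃⟶∀¬ ¬∃¬ x))

module _ {c ℓ₁ ℓ₂ : Level} (P : Poset c ℓ₁ ℓ₂) where
  open Poset P

  ∉↑⇔agreeOn-∅-↓ : (F : List Carrier) (x : Carrier) →
    (¬ ↑ P F x) ⇔ AgreeOn P F (∅ P) (↓ P x)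
  ∉↑⇔agreeOn-∅-↓ F x =
    mk⇔ (All.map ≰⇒agree ∘ ¬Any⇒All¬ F) (All¬⇒¬Any ∘ All.map agree⇒≰)
    where
    ≰⇒agree : {y : Carrier} → ¬ y ≤ x → (∅ P y → ↓ P x y) × (↓ P x y → ∅ P y)
    ≰⇒agree y≰x = (λ ()) , ⊥-elim ∘ y≰x

    agree⇒≰ : {y : Carrier} → (∅ P y → ↓ P x y) × (↓ P x y → ∅ P y) → ¬ y ≤ x
    agree⇒≰ (_ , ↓⊆∅) = Polymorphic.⊥-elim ∘ ↓⊆∅

  inClosureDown-∅⇔noFiniteGenerators :
    InClosureDown P (∅ P) ⇔ ((F : List Carrier) → ∃[ x ] ¬ ↑ P F x)
  inClosureDown-∅⇔noFiniteGenerators = mk⇔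
    (λ cl F → map₂ (Equivalence.from (∉↑⇔agreeOn-∅-↓ F _)) (cl F))
    (λ gen F → map₂ (Equivalence.to (∉↑⇔agreeOn-∅-↓ F _)) (gen F))

corollary1 : {c ℓ₁ ℓ₂ : Level} → ExcludedMiddle (c ⊔ ℓ₂) → (P : Poset c ℓ₁ ℓ₂) →
    (¬ InClosureDown P (∅ P)) ⇔ FinitelyGeneratedFinalSegment P
corollary1 {ℓ₂ = ℓ₂} em P =
  ¬∀∃¬⇔∃∀ {q = ℓ₂} (em⇒dne em) ⇔-∘ ¬-cong-⇔ (inClosureDown-∅⇔noFiniteGenerators P)
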